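{- Let $(W,\preccurlyeq)$ be a poset and $S\colon W\to W$ any function. The following are equivalent: (1) $S$ is forward confluent, i.e. $w\preccurlyeq v$ implies $S(w)\preccurlyeq S(v)$; (2) for every monotone valuation $V$ on $W$ and every formula $\varphi$ of $\mathsf L$, truth of $\varphi$ in $(W,\preccurlyeq,S,V)$ is monotone with respect to $\preccurlyeq$, i.e. if $w\preccurlyeq v$ and $w\models\varphi$ then $v\models\varphi$.
   Context: Formulas of $\mathsf L$: $p \mid \bot \mid \wedge \mid \vee \mid \to \mid \bigcirc \mid \Diamond \mid \Box \mid \mathsf U \mid \mathsf R$ over a countable set $\mathbb P$ of variables. A valuation $V\colon W\to\mathcal P(\mathbb P)$ is monotone if $w\preccurlyeq v$ implies $V(w)\subseteq V(v)$. Satisfaction in $(W,\preccurlyeq,S,V)$ (for an arbitrary function $S$): $w\models p$ iff $p\in V(w)$; $\bot$ false; $\wedge,\vee$ classical; $w\models\bigcirc\varphi$ iff $S(w)\models\varphi$; $w\models\varphi\to\psi$ iff every $v\succcurlyeq w$ with $v\models\varphi$ has $v\models\psi$; $w\models\Diamond\varphi$ iff $S^k(w)\models\varphi$ for some $k\ge0$; $w\models\Box\varphi$ iff $S^k(w)\models\varphi$ for all $k\ge0$; $w\models\varphi\,\mathsf U\,\psi$ iff some $k\ge0$ has $S^k(w)\models\psi$ and $S^i(w)\models\varphi$ for all $i<k$; $w\models\varphi\,\mathsf R\,\psi$ iff for all $k\ge0$, $S^k(w)\models\psi$ or $S^i(w)\models\varphi$ for some $i<k$. -}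

module Defs where

open import Level using (Level; _⊔_)
open import Data.Nat using (ℕ; zero; suc; _<_)
open import Data.Product using (_×_; Σ-syntax)
open import Data.Sum using (_⊎_)
open import Data.Empty.Polymorphic using (⊥)
open import Relation.Binary.Bundles using (Poset)

data Formula : Set where
  var  : ℕ → Formula
  ⊥'   : Formula
  _∧'_ : Formula → Formula → Formula
  _∨'_ : Formula → Formula → Formula
  _⇒'_ : Formula → Formula → Formula
  ○    : Formula → Formula
  ◇    : Formula → Formula
  □    : Formula → Formula
  _U_  : Formula → Formula → Formula
  _R_  : Formula → Formula → Formula

iter : ∀ {a} {A : Set a} → (A → A) → ℕ → A → A
iter S zero    w = w
iter S (suc k) w = S (iter S k w)

module _ {c ℓ₁ ℓ₂ : Level} (P : Poset c ℓ₁ ℓ₂) where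
  open Poset P renaming (Carrier to W; _≤_ to _≼_)

  Valuation : Set (c Level.⊔ Level.suc ℓ₂)
  Valuation = W → ℕ → Set ℓ₂

  MonotoneValuation : Valuation → Set (c ⊔ ℓ₂)
  MonotoneValuation V = ∀ {w v} → w ≼ v → ∀ p → V w p → V v p

  ForwardConfluent : (W → W) → Set (c ⊔ ℓ₂)
  ForwardConfluent S = ∀ {w v} → w ≼ v → S w ≼ S v

  Sat : (W → W) → Valuation → W → Formula → Set (c ⊔ ℓ₂)
  Sat S V w (var p)   = Level.Lift (c ⊔ ℓ₂) (V w p)
  Sat S V w ⊥'        = ⊥
  Sat S V w (φ ∧' ψ)  = Sat S V w φ × Sat S V w ψ
  Sat S V w (φ ∨' ψ)  = Sat S V w φ ⊎ Sat S V w ψ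
  Sat S V w (φ ⇒' ψ)  = ∀ v → w ≼ v → Sat S V v φ → Sat S V v ψ
  Sat S V w (○ φ)     = Sat S V (S w) φ
  Sat S V w (◇ φ)     = Σ[ k ∈ ℕ ] Sat S V (iter S k w) φ
  Sat S V w (□ φ)     = ∀ k → Sat S V (iter S k w) φ
  Sat S V w (φ U ψ)   = Σ[ k ∈ ℕ ] (Sat S V (iter S k w) ψ × (∀ i → i < k → Sat S V (iter S i w) φ))
  Sat S V w (φ R ψ)   = ∀ k → Sat S V (iter S k w) ψ ⊎ (Σ[ i ∈ ℕ ] (i < k × Sat S V (iter S i w) φ))

  TruthMonotone : (W → W) → Set (c Level.⊔ Level.suc ℓ₂)
  TruthMonotone S = ∀ (V : Valuation) → MonotoneValuation V →
    ∀ (φ : Formula) {w v} → w ≼ v → Sat S V w φ → Sat S V v φ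

module Submission where

open import Defs
open import Level using (Level; lift; lower)
open import Data.Nat using (ℕ; zero; suc)
open import Data.Product using (_×_; _,_)
open import Data.Sum using (inj₁; inj₂)
open import Relation.Binary.Bundles using (Poset)

-- (1 ⇒ 2) is an induction on φ: forward confluence, iterated, moves every
-- future S^k(w) above the corresponding S^k(v), and → is handled by
-- transitivity.  (2 ⇒ 1): in the valuation that makes one variable true
-- exactly on the upset of S(w), the formula ○p holds at w, so by
-- monotonicity it holds at every v ≽ w, i.e. S(w) ≼ S(v).

module _ {c ℓ₁ ℓ₂ : Level} (P : Poset c ℓ₁ ℓ₂) where
  open Poset P renaming (Carrier to W; _≤_ to _≼_)

  iter-mono : ∀ {S : W → W} → ForwardConfluent P S →
    ∀ k {w v} → w ≼ v → iter S k w ≼ iter S k v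
  iter-mono fc zero    w≼v = w≼v
  iter-mono fc (suc k) w≼v = fc (iter-mono fc k w≼v)

  upsetValuation : W → Valuation P
  upsetValuation a x _ = a ≼ x

  upsetValuation-monotone : ∀ a → MonotoneValuation P (upsetValuation a)
  upsetValuation-monotone a x≼y _ a≼x = trans a≼x x≼y

  module _ {S : W → W} (fc : ForwardConfluent P S)
           {V : Valuation P} (mv : MonotoneValuation P V) where

    Sat-mono : ∀ φ {w v} → w ≼ v → Sat P S V w φ → Sat P S V v φ
    Sat-mono (var p)  w≼v (lift x)       = lift (mv w≼v p x)
    Sat-mono ⊥'       w≼v ()
    Sat-mono (φ ∧' ψ) w≼v (a , b)        = Sat-mono φ w≼v a , Sat-mono ψ w≼v b
    Sat-mono (φ ∨' ψ) w≼v (inj₁ a)       = inj₁ (Sat-mono φ w≼v a)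
    Sat-mono (φ ∨' ψ) w≼v (inj₂ b)       = inj₂ (Sat-mono ψ w≼v b)
    Sat-mono (φ ⇒' ψ) w≼v h u v≼u        = h u (trans w≼v v≼u)
    Sat-mono (○ φ)    w≼v h              = Sat-mono φ (fc w≼v) h
    Sat-mono (◇ φ)    w≼v (k , h)        = k , Sat-mono φ (iter-mono fc k w≼v) h
    Sat-mono (□ φ)    w≼v h k            = Sat-mono φ (iter-mono fc k w≼v) (h k)
    Sat-mono (φ U ψ)  w≼v (k , h , g)    =
      k , Sat-mono ψ (iter-mono fc k w≼v) h ,
      λ i i<k → Sat-mono φ (iter-mono fc i w≼v) (g i i<k)
    Sat-mono (φ R ψ)  w≼v h k with h k
    ... | inj₁ a             = inj₁ (Sat-mono ψ (iter-mono fc k w≼v) a)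
    ... | inj₂ (i , i<k , b) = inj₂ (i , i<k , Sat-mono φ (iter-mono fc i w≼v) b)

  forwardConfluent⇒truthMonotone : ∀ {S : W → W} →
    ForwardConfluent P S → TruthMonotone P S
  forwardConfluent⇒truthMonotone fc V mv = Sat-mono fc mv

  truthMonotone⇒forwardConfluent : ∀ {S : W → W} →
    TruthMonotone P S → ForwardConfluent P S
  truthMonotone⇒forwardConfluent {S} tm {w} w≼v =
    lower (tm (upsetValuation (S w)) (upsetValuation-monotone (S w))
              (○ (var 0)) w≼v (lift refl))

proposition2p1 : ∀ {c ℓ₁ ℓ₂ : Level} (P : Poset c ℓ₁ ℓ₂) (S : Poset.Carrier P → Poset.Carrier P) →
    (ForwardConfluent P S → TruthMonotone P S) × (TruthMonotone P S → ForwardConfluent P S)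
proposition2p1 P S = forwardConfluent⇒truthMonotone P , truthMonotone⇒forwardConfluent P
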